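{- Let $R=M_n(F)$ where $n>1$ and $F$ is a finite field. Let $U$ be a subgroup of $GL_n(F)$ with $-I_n\in U$ such that $\Gamma(R,U)$ is connected. Let $\Gamma(R,S)$ be a $U$-unitary Cayley graph with $S\neq\emptyset$. Then $\Gamma(R,S)$ is connected.
   Context: For $S\subseteq R$ with $0\notin S$, $S=-S$, the Cayley graph $\Gamma(R,S)$ has vertex set $R$, with $a,b$ adjacent iff $a-b\in S$. It is $U$-unitary if $USU=S$. -}

module Defs where

open import Level using (Level; _⊔_)
open import Algebra.Bundles using (CommutativeRing)
open import Data.Nat using (ℕ; zero; suc)
open import Data.Fin using (Fin; zero; suc; _≟_)
open import Data.Product using (Σ; ∃; _×_; _,_)
open import Data.List using (List)
open import Data.List.Relation.Unary.Any using (Any)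
open import Relation.Nullary using (¬_; yes; no)

module _ {c ℓ : Level} (F : CommutativeRing c ℓ) where
  open CommutativeRing F hiding (zero)

  -- F is a field: 0 ≠ 1 and every nonzero element has a multiplicative inverse.
  -- F is finite: some list enumerates all elements (up to the ring's equality ≈).
  record IsFiniteField : Set (c ⊔ ℓ) where
    field
      0≉1      : ¬ (0# ≈ 1#)
      inverse  : ∀ x → ¬ (x ≈ 0#) → ∃ λ y → x * y ≈ 1#
      elements : List Carrier
      complete : ∀ x → Any (x ≈_) elements

  Mat : ℕ → Set c
  Mat n = Fin n → Fin n → Carrier

  _≈ₘ_ : ∀ {n} → Mat n → Mat n → Set ℓ
  A ≈ₘ B = ∀ i j → A i j ≈ B i j

  Σᶠ : ∀ n → (Fin n → Carrier) → Carrier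
  Σᶠ zero    f = 0#
  Σᶠ (suc n) f = f zero + Σᶠ n (λ i → f (suc i))

  _+ₘ_ : ∀ {n} → Mat n → Mat n → Mat n
  (A +ₘ B) i j = A i j + B i j

  -ₘ_ : ∀ {n} → Mat n → Mat n
  (-ₘ A) i j = - (A i j)

  _-ₘ_ : ∀ {n} → Mat n → Mat n → Mat n
  A -ₘ B = A +ₘ (-ₘ B)

  _*ₘ_ : ∀ {n} → Mat n → Mat n → Mat n
  _*ₘ_ {n} A B i j = Σᶠ n (λ k → A i k * B k j)

  0ₘ : ∀ {n} → Mat n
  0ₘ i j = 0#

  Iₘ : ∀ {n} → Mat n
  Iₘ i j with i ≟ j
  ... | yes _ = 1#
  ... | no  _ = 0#

  Invertible : ∀ {n} → Mat n → Set (c ⊔ ℓ)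
  Invertible {n} A = ∃ λ (B : Mat n) → ((A *ₘ B) ≈ₘ Iₘ) × ((B *ₘ A) ≈ₘ Iₘ)

  -- subsets of M_n(F) are predicates respecting matrix equality
  Respects : ∀ {p n} → (Mat n → Set p) → Set (c ⊔ ℓ ⊔ p)
  Respects P = ∀ {A B} → A ≈ₘ B → P A → P B

  record IsSubgroupGL {p} (n : ℕ) (U : Mat n → Set p) : Set (c ⊔ ℓ ⊔ p) where
    field
      resp     : Respects U
      ⊆GL      : ∀ {A} → U A → Invertible A
      has-I    : U Iₘ
      *-closed : ∀ {A B} → U A → U B → U (A *ₘ B)
      inv-closed : ∀ {A B} → U A → (A *ₘ B) ≈ₘ Iₘ → (B *ₘ A) ≈ₘ Iₘ → U B

  record IsConnectionSet {p} (n : ℕ) (S : Mat n → Set p) : Set (c ⊔ ℓ ⊔ p) where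
    field
      resp   : Respects S
      0∉S    : ¬ S 0ₘ
      symm   : ∀ {A} → S A → S (-ₘ A)

  -- Γ(R,S) is U-unitary: U S U = S
  IsUnitary : ∀ {p q n} → (Mat n → Set p) → (Mat n → Set q) → Set (c ⊔ ℓ ⊔ p ⊔ q)
  IsUnitary {n = n} U S =
    (∀ {u s v} → U u → S s → U v → S ((u *ₘ s) *ₘ v)) ×
    (∀ {s} → S s → ∃ λ (u : Mat n) → ∃ λ (s′ : Mat n) → ∃ λ (v : Mat n) →
        U u × S s′ × U v × (s ≈ₘ ((u *ₘ s′) *ₘ v)))

  -- walks in the Cayley graph Γ(M_n(F), S): a ~ b iff a - b ∈ S
  data Walk {p n} (S : Mat n → Set p) : Mat n → Mat n → Set (c ⊔ ℓ ⊔ p) where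
    here : ∀ {a b} → a ≈ₘ b → Walk S a b
    step : ∀ {a b d} → S (a -ₘ b) → Walk S b d → Walk S a d

  CayleyConnected : ∀ {p n} → (Mat n → Set p) → Set (c ⊔ ℓ ⊔ p)
  CayleyConnected {n = n} S = ∀ (a b : Mat n) → Walk S a b

{-# OPTIONS --safe #-}
module Submission where

-- A walk from x to 0 in Γ(R,S) writes x as a sum of elements of S, and Γ(R,S) is connected once
-- every matrix is such a sum. Connectivity of Γ(R,U) makes every matrix a sum of elements of U, so
-- USU ⊆ S lets a·s·b be expanded into terms u·s·v: the sums of elements of S form a two-sided
-- ideal J of M_n(F). Sandwiching s between matrix units puts every entry of s into the ideal
-- {v | v·E_kl ∈ J for all k, l} of F; since s ≠ 0 and F is a field this ideal contains 1, so all
-- v·E_kl, and hence all matrices, lie in J. Only connectivity of Γ(R,U) and USU ⊆ S are used.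

open import Defs hiding (_≈ₘ_; _+ₘ_; _-ₘ_; _*ₘ_; 0ₘ)
import Defs
open import Level using (Level; _⊔_)
open import Algebra.Bundles using (CommutativeRing)
open import Data.Nat using (ℕ; _<_)
import Data.Nat as ℕ
import Data.Nat.Properties as ℕ
open import Data.Fin as Fin using (Fin; zero; suc; toℕ)
open import Data.Fin.Properties using (pigeonhole)
open import Data.Product using (∃; ∃₂; _×_; _,_; proj₁; proj₂)
open import Data.List using (List; length; lookup)
open import Data.List.Relation.Unary.Any using (Any; index)
open import Data.List.Relation.Unary.Any.Properties using (lookup-index)
open import Data.Vec.Functional.Relation.Binary.Equality.Setoid using (≋-setoid)
open import Function using (_∘_)
open import Relation.Binary.Bundles using (Setoid)
open import Relation.Nullary using (¬_)
open import Relation.Binary.PropositionalEquality as ≡ using (_≡_)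

module _ {c ℓ : Level} (F : CommutativeRing c ℓ) where
  open CommutativeRing F hiding (zero)
  open import Algebra.Properties.Semiring.Sum semiring
    using (sum; sum-cong-≋; sum-replicate-zero; ∑-distrib-+; *-distribˡ-sum)
  open import Algebra.Solver.Ring.NaturalCoefficients.Default commutativeSemiring
    using (solve; _:+_; _:*_; _:=_)
  open import Algebra.Properties.AbelianGroup +-abelianGroup using (//-rightDividesˡ; ε⁻¹≈ε; ⁻¹-∙-comm)
  open import Algebra.Properties.Semiring.Exp semiring using (_^_; ^-homo-*)
  open import Relation.Binary.Reasoning.Setoid setoid

  [x+z]-[y+z]≈x-y : ∀ x y z → (x + z) - (y + z) ≈ x - y
  [x+z]-[y+z]≈x-y x y z = begin
    (x + z) - (y + z)      ≈⟨ +-congˡ (⁻¹-∙-comm y z) ⟨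
    (x + z) + (- y + - z)  ≈⟨ regroup x z (- y) (- z) ⟩
    (x - y) + (z - z)      ≈⟨ +-congˡ (-‿inverseʳ z) ⟩
    (x - y) + 0#           ≈⟨ +-identityʳ _ ⟩
    x - y                  ∎
    where
    regroup : ∀ a b d e → (a + b) + (d + e) ≈ (a + d) + (b + e)
    regroup = solve 4 (λ a b d e → (a :+ b) :+ (d :+ e) := (a :+ d) :+ (b :+ e)) refl

  Σᶠ≡sum : ∀ n (f : Fin n → Carrier) → Σᶠ F n f ≡ sum f
  Σᶠ≡sum ℕ.zero    f = ≡.refl
  Σᶠ≡sum (ℕ.suc n) f = ≡.cong (f zero +_) (Σᶠ≡sum n (f ∘ suc))

  Σᶠ-cong : ∀ {n} {f g : Fin n → Carrier} → (∀ i → f i ≈ g i) → Σᶠ F n f ≈ Σᶠ F n g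
  Σᶠ-cong {n} {f} {g} f≈g rewrite Σᶠ≡sum n f | Σᶠ≡sum n g = sum-cong-≋ f≈g

  Σᶠ-zero : ∀ {n} {f : Fin n → Carrier} → (∀ i → f i ≈ 0#) → Σᶠ F n f ≈ 0#
  Σᶠ-zero {n} {f} f≈0 rewrite Σᶠ≡sum n f = trans (sum-cong-≋ f≈0) (sum-replicate-zero n)

  Σᶠ-distrib-+ : ∀ {n} (f g : Fin n → Carrier) → Σᶠ F n (λ i → f i + g i) ≈ Σᶠ F n f + Σᶠ F n g
  Σᶠ-distrib-+ {n} f g rewrite Σᶠ≡sum n (λ i → f i + g i) | Σᶠ≡sum n f | Σᶠ≡sum n g = ∑-distrib-+ f g

  *-distribˡ-Σᶠ : ∀ {n} x (f : Fin n → Carrier) → x * Σᶠ F n f ≈ Σᶠ F n (λ i → x * f i)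
  *-distribˡ-Σᶠ {n} x f rewrite Σᶠ≡sum n f | Σᶠ≡sum n (λ i → x * f i) = *-distribˡ-sum x f

  δ : ∀ {n} → Fin n → Fin n → Carrier
  δ zero    zero    = 1#
  δ zero    (suc _) = 0#
  δ (suc _) zero    = 0#
  δ (suc i) (suc j) = δ i j

  δ-sym : ∀ {n} (i j : Fin n) → δ i j ≡ δ j i
  δ-sym zero    zero    = ≡.refl
  δ-sym zero    (suc _) = ≡.refl
  δ-sym (suc _) zero    = ≡.refl
  δ-sym (suc i) (suc j) = δ-sym i j

  δ-diag : ∀ {n} (i : Fin n) → δ i i ≡ 1#
  δ-diag zero    = ≡.refl
  δ-diag (suc i) = δ-diag i

  Σᶠ-select : ∀ {n} (p : Fin n) (f : Fin n → Carrier) → Σᶠ F n (λ k → δ p k * f k) ≈ f p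
  Σᶠ-select {ℕ.suc n} zero    f = begin
    1# * f zero + Σᶠ F n (λ k → 0# * f (suc k))  ≈⟨ +-cong (*-identityˡ _) (Σᶠ-zero {n} (zeroˡ ∘ f ∘ suc)) ⟩
    f zero + 0#                                  ≈⟨ +-identityʳ _ ⟩
    f zero                                       ∎
  Σᶠ-select {ℕ.suc n} (suc p) f = begin
    0# * f zero + Σᶠ F n (λ k → δ p k * f (suc k))  ≈⟨ +-cong (zeroˡ _) (Σᶠ-select p (f ∘ suc)) ⟩
    0# + f (suc p)                                 ≈⟨ +-identityˡ _ ⟩
    f (suc p)                                      ∎

  infix  4 _≈ₘ_
  infixl 6 _+ₘ_ _-ₘ_
  infixl 7 _*ₘ_

  _≈ₘ_ : ∀ {n} → Mat F n → Mat F n → Set ℓ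
  _≈ₘ_ = Defs._≈ₘ_ F

  _+ₘ_ _-ₘ_ _*ₘ_ : ∀ {n} → Mat F n → Mat F n → Mat F n
  _+ₘ_ = Defs._+ₘ_ F
  _-ₘ_ = Defs._-ₘ_ F
  _*ₘ_ = Defs._*ₘ_ F

  0ₘ : ∀ {n} → Mat F n
  0ₘ = Defs.0ₘ F

  Matₛ : ℕ → Setoid c ℓ
  Matₛ n = ≋-setoid (≋-setoid setoid n) n

  module _ {n : ℕ} where
    open Setoid (Matₛ n) public using () renaming (refl to ≈ₘ-refl; sym to ≈ₘ-sym; trans to ≈ₘ-trans)

  *ₘ-cong : ∀ {n} {A A′ B B′ : Mat F n} → A ≈ₘ A′ → B ≈ₘ B′ → A *ₘ B ≈ₘ A′ *ₘ B′
  *ₘ-cong A≈A′ B≈B′ i j = Σᶠ-cong (λ k → *-cong (A≈A′ i k) (B≈B′ k j))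

  *ₘ-zeroʳ : ∀ {n} (A : Mat F n) → A *ₘ 0ₘ ≈ₘ 0ₘ
  *ₘ-zeroʳ A i j = Σᶠ-zero (λ k → zeroʳ (A i k))

  *ₘ-zeroˡ : ∀ {n} (A : Mat F n) → 0ₘ *ₘ A ≈ₘ 0ₘ
  *ₘ-zeroˡ A i j = Σᶠ-zero (λ k → zeroˡ (A k j))

  *ₘ-distribˡ : ∀ {n} (A B C : Mat F n) → A *ₘ (B +ₘ C) ≈ₘ A *ₘ B +ₘ A *ₘ C
  *ₘ-distribˡ A B C i j =
    trans (Σᶠ-cong (λ k → distribˡ (A i k) (B k j) (C k j)))
          (Σᶠ-distrib-+ (λ k → A i k * B k j) (λ k → A i k * C k j))

  *ₘ-distribʳ : ∀ {n} (A B C : Mat F n) → (B +ₘ C) *ₘ A ≈ₘ B *ₘ A +ₘ C *ₘ A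
  *ₘ-distribʳ A B C i j =
    trans (Σᶠ-cong (λ k → distribʳ (A k j) (B i k) (C i k)))
          (Σᶠ-distrib-+ (λ k → B i k * A k j) (λ k → C i k * A k j))

  singleEntry : ∀ {n} → Fin n → Fin n → Carrier → Mat F n
  singleEntry k l v p q = (δ p k * v) * δ l q

  singleEntry-cong : ∀ {n} (k l : Fin n) {v w} → v ≈ w → singleEntry k l v ≈ₘ singleEntry k l w
  singleEntry-cong k l v≈w p q = *-congʳ (*-congˡ v≈w)

  singleEntry-zero : ∀ {n} (k l : Fin n) → singleEntry k l 0# ≈ₘ 0ₘ
  singleEntry-zero k l p q = trans (*-congʳ (zeroʳ (δ p k))) (zeroˡ (δ l q))

  singleEntry-+ : ∀ {n} (k l : Fin n) v w → singleEntry k l (v + w) ≈ₘ singleEntry k l v +ₘ singleEntry k l w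
  singleEntry-+ k l v w p q =
    trans (*-congʳ (distribˡ (δ p k) v w)) (distribʳ (δ l q) (δ p k * v) (δ p k * w))

  singleEntry-diag : ∀ {n} (k l : Fin n) v → singleEntry k l v k l ≈ v
  singleEntry-diag k l v rewrite δ-diag k | δ-diag l = trans (*-identityʳ _) (*-identityˡ v)

  singleEntry-*ₘ : ∀ {n} (k i : Fin n) v (A : Mat F n) p q → (singleEntry k i v *ₘ A) p q ≈ (δ p k * v) * A i q
  singleEntry-*ₘ {n} k i v A p q = begin
    Σᶠ F n (λ m → ((δ p k * v) * δ i m) * A m q)  ≈⟨ Σᶠ-cong (λ m → *-assoc _ (δ i m) (A m q)) ⟩
    Σᶠ F n (λ m → (δ p k * v) * (δ i m * A m q))  ≈⟨ *-distribˡ-Σᶠ _ (λ m → δ i m * A m q) ⟨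
    (δ p k * v) * Σᶠ F n (λ m → δ i m * A m q)    ≈⟨ *-congˡ (Σᶠ-select i (λ m → A m q)) ⟩
    (δ p k * v) * A i q                           ∎

  *ₘ-singleEntry : ∀ {n} (A : Mat F n) (j l : Fin n) v p q → (A *ₘ singleEntry j l v) p q ≈ (A p j * v) * δ l q
  *ₘ-singleEntry {n} A j l v p q = begin
    Σᶠ F n (λ r → A p r * ((δ r j * v) * δ l q))  ≈⟨ Σᶠ-cong move-δ ⟩
    Σᶠ F n (λ r → δ j r * ((A p r * v) * δ l q))  ≈⟨ Σᶠ-select j (λ r → (A p r * v) * δ l q) ⟩
    (A p j * v) * δ l q                           ∎
    where
    move-δ : ∀ r → A p r * ((δ r j * v) * δ l q) ≈ δ j r * ((A p r * v) * δ l q)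
    move-δ r rewrite δ-sym r j =
      solve 4 (λ a d v e → a :* ((d :* v) :* e) := d :* ((a :* v) :* e)) refl (A p r) (δ j r) v (δ l q)

  singleEntry-sandwich : ∀ {n} (k i j l : Fin n) v w (A : Mat F n) →
                  singleEntry k i v *ₘ A *ₘ singleEntry j l w ≈ₘ singleEntry k l (v * A i j * w)
  singleEntry-sandwich k i j l v w A p q = begin
    (singleEntry k i v *ₘ A *ₘ singleEntry j l w) p q  ≈⟨ *ₘ-singleEntry (singleEntry k i v *ₘ A) j l w p q ⟩
    ((singleEntry k i v *ₘ A) p j * w) * δ l q  ≈⟨ *-congʳ (*-congʳ (singleEntry-*ₘ k i v A p j)) ⟩
    (((δ p k * v) * A i j) * w) * δ l q  ≈⟨ *-congʳ (reassoc (δ p k) v (A i j) w) ⟩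
    (δ p k * (v * A i j * w)) * δ l q    ∎
    where
    reassoc : ∀ d v a w → ((d * v) * a) * w ≈ d * (v * a * w)
    reassoc = solve 4 (λ d v a w → ((d :* v) :* a) :* w := d :* ((v :* a) :* w)) refl

  Σₘ : ∀ {n} m → (Fin m → Mat F n) → Mat F n
  Σₘ m G p q = Σᶠ F m (λ k → G k p q)

  Σₘ-singleEntries : ∀ {n} (A : Mat F n) → A ≈ₘ Σₘ n (λ k → Σₘ n (λ l → singleEntry k l (A k l)))
  Σₘ-singleEntries {n} A p q = sym (begin
    Σᶠ F n (λ k → Σᶠ F n (λ l → (δ p k * A k l) * δ l q))  ≈⟨ Σᶠ-cong (λ k → Σᶠ-cong (λ l → δ-first k l)) ⟩
    Σᶠ F n (λ k → Σᶠ F n (λ l → δ q l * (δ p k * A k l)))  ≈⟨ Σᶠ-cong (λ k → Σᶠ-select q (λ l → δ p k * A k l)) ⟩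
    Σᶠ F n (λ k → δ p k * A k q)                           ≈⟨ Σᶠ-select p (λ k → A k q) ⟩
    A p q                                                  ∎)
    where
    δ-first : ∀ k l → (δ p k * A k l) * δ l q ≈ δ q l * (δ p k * A k l)
    δ-first k l rewrite δ-sym l q = *-comm _ _

  IsSumOf : ∀ {n q} → (Mat F n → Set q) → Mat F n → Set (c ⊔ ℓ ⊔ q)
  IsSumOf S x = Walk F S x 0ₘ

  module _ {n q} {S : Mat F n → Set q} where

    walk-respʳ : ∀ {a b b′} → Walk F S a b → b ≈ₘ b′ → Walk F S a b′
    walk-respʳ (here a≈b)   b≈b′ = here (≈ₘ-trans a≈b b≈b′)
    walk-respʳ (step s w) b≈b′ = step s (walk-respʳ w b≈b′)

    module _ (S-resp : Respects F S) where

      walk-respˡ : ∀ {a a′ b} → a ≈ₘ a′ → Walk F S a b → Walk F S a′ b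
      walk-respˡ a≈a′ (here a≈b)  = here (≈ₘ-trans (≈ₘ-sym a≈a′) a≈b)
      walk-respˡ a≈a′ (step s w) = step (S-resp (λ i j → +-congʳ (a≈a′ i j)) s) w

      walk-++ : ∀ {a b d} → Walk F S a b → Walk F S b d → Walk F S a d
      walk-++ (here a≈b)  w′ = walk-respˡ (≈ₘ-sym a≈b) w′
      walk-++ (step s w) w′ = step s (walk-++ w w′)

      walk-translate : ∀ {a b} y → Walk F S a b → Walk F S (a +ₘ y) (b +ₘ y)
      walk-translate y (here a≈b) = here (λ i j → +-congʳ (a≈b i j))
      walk-translate {a} y (step {b = b} s w) =
        step (S-resp (λ i j → sym ([x+z]-[y+z]≈x-y (a i j) (b i j) (y i j))) s) (walk-translate y w)

      isSumOf-∈ : ∀ {x} → S x → IsSumOf S x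
      isSumOf-∈ {x} s =
        step (S-resp (λ i j → sym (trans (+-congˡ ε⁻¹≈ε) (+-identityʳ (x i j)))) s) (here ≈ₘ-refl)

      isSumOf-+ : ∀ {x y} → IsSumOf S x → IsSumOf S y → IsSumOf S (x +ₘ y)
      isSumOf-+ {y = y} x-sum y-sum =
        walk-++ (walk-respʳ (walk-translate y x-sum) (λ i j → +-identityˡ (y i j))) y-sum

      isSumOf-Σₘ : ∀ m (G : Fin m → Mat F n) → (∀ k → IsSumOf S (G k)) → IsSumOf S (Σₘ m G)
      isSumOf-Σₘ ℕ.zero    G G-sums = here ≈ₘ-refl
      isSumOf-Σₘ (ℕ.suc m) G G-sums = isSumOf-+ (G-sums zero) (isSumOf-Σₘ m (G ∘ suc) (G-sums ∘ suc))

      all-isSumOf⇒connected : (∀ x → IsSumOf S x) → CayleyConnected F S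
      all-isSumOf⇒connected sums a b =
        walk-respˡ (λ i j → //-rightDividesˡ (b i j) (a i j))
          (walk-respʳ (walk-translate b (sums (a -ₘ b))) (λ i j → +-identityˡ (b i j)))

  record IsAdditive {n} (f : Mat F n → Mat F n) : Set (c ⊔ ℓ) where
    field
      cong   : ∀ {A B} → A ≈ₘ B → f A ≈ₘ f B
      homo-+ : ∀ A B → f (A +ₘ B) ≈ₘ f A +ₘ f B
      homo-0 : f 0ₘ ≈ₘ 0ₘ

  *ₘ-additiveˡ : ∀ {n} (A : Mat F n) → IsAdditive (A *ₘ_)
  *ₘ-additiveˡ A = record { cong = *ₘ-cong ≈ₘ-refl ; homo-+ = *ₘ-distribˡ A ; homo-0 = *ₘ-zeroʳ A }

  *ₘ-additiveʳ : ∀ {n} (A : Mat F n) → IsAdditive (_*ₘ A)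
  *ₘ-additiveʳ A = record
    { cong = λ B≈B′ → *ₘ-cong B≈B′ ≈ₘ-refl ; homo-+ = λ B C → *ₘ-distribʳ A B C ; homo-0 = *ₘ-zeroˡ A }

  ∘-additive : ∀ {n} {f g : Mat F n → Mat F n} → IsAdditive f → IsAdditive g → IsAdditive (f ∘ g)
  ∘-additive f-add g-add = record
    { cong   = Af.cong ∘ Ag.cong
    ; homo-+ = λ A B → ≈ₘ-trans (Af.cong (Ag.homo-+ A B)) (Af.homo-+ _ _)
    ; homo-0 = ≈ₘ-trans (Af.cong Ag.homo-0) Af.homo-0
    }
    where
    module Af = IsAdditive f-add
    module Ag = IsAdditive g-add

  additive-preserves-isSumOf : ∀ {n p q} {S : Mat F n → Set p} {T : Mat F n → Set q} {f : Mat F n → Mat F n} →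
    IsAdditive f → Respects F T → (∀ {x} → S x → IsSumOf T (f x)) → ∀ {x} → IsSumOf S x → IsSumOf T (f x)
  additive-preserves-isSumOf f-add T-resp f-S (here x≈0) = here (≈ₘ-trans (cong x≈0) homo-0)
    where open IsAdditive f-add
  additive-preserves-isSumOf {f = f} f-add T-resp f-S (step {a} {b} s w) =
    walk-respˡ T-resp f-split (isSumOf-+ T-resp (f-S s) (additive-preserves-isSumOf f-add T-resp f-S w))
    where
    open IsAdditive f-add
    f-split : f (a -ₘ b) +ₘ f b ≈ₘ f a
    f-split = ≈ₘ-trans (≈ₘ-sym (homo-+ _ _)) (cong (λ i j → //-rightDividesˡ (b i j) (a i j)))

  module _ {n p q} {U : Mat F n → Set p} {S : Mat F n → Set q}
           (U-connected : CayleyConnected F U) (S-resp : Respects F S)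
           (USU⊆S : ∀ {u s v} → U u → S s → U v → S (u *ₘ s *ₘ v)) where

    isSumOf-sandwich : ∀ {x} → IsSumOf S x → ∀ a b → IsSumOf S (a *ₘ x *ₘ b)
    isSumOf-sandwich x-sum a b =
      additive-preserves-isSumOf (∘-additive (*ₘ-additiveʳ b) (*ₘ-additiveˡ a)) S-resp
        (λ s → *s*-isSumOf s a b) x-sum
      where
      us*-isSumOf : ∀ {u s} → U u → S s → ∀ b → IsSumOf S (u *ₘ s *ₘ b)
      us*-isSumOf u s b =
        additive-preserves-isSumOf (*ₘ-additiveˡ _) S-resp
          (λ v → isSumOf-∈ S-resp (USU⊆S u s v)) (U-connected b 0ₘ)
      *s*-isSumOf : ∀ {s} → S s → ∀ a b → IsSumOf S (a *ₘ s *ₘ b)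
      *s*-isSumOf s a b =
        additive-preserves-isSumOf (∘-additive (*ₘ-additiveʳ b) (*ₘ-additiveʳ _)) S-resp
          (λ u → us*-isSumOf u s b) (U-connected a 0ₘ)

  *-cancelˡ-unit : ∀ {x z a b} → x * z ≈ 1# → x * a ≈ x * b → a ≈ b
  *-cancelˡ-unit {x} {z} {a} {b} xz≈1 xa≈xb = begin
    a            ≈⟨ z[xy]≈y a ⟨
    z * (x * a)  ≈⟨ *-congˡ xa≈xb ⟩
    z * (x * b)  ≈⟨ z[xy]≈y b ⟩
    b            ∎
    where
    z[xy]≈y : ∀ y → z * (x * y) ≈ y
    z[xy]≈y y = trans (sym (*-assoc z x y)) (trans (*-congʳ (trans (*-comm z x) xz≈1)) (*-identityˡ y))

  ^-cancelˡ-unit : ∀ {x z} → x * z ≈ 1# → ∀ i {a b} → x ^ i * a ≈ x ^ i * b → a ≈ b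
  ^-cancelˡ-unit xz≈1 ℕ.zero    {a} {b} eq = trans (sym (*-identityˡ a)) (trans eq (*-identityˡ b))
  ^-cancelˡ-unit xz≈1 (ℕ.suc i) {a} {b} eq =
    ^-cancelˡ-unit xz≈1 i (*-cancelˡ-unit xz≈1 (trans (sym (*-assoc _ _ a)) (trans eq (*-assoc _ _ b))))

  -- Pigeonhole on x⁰, …, xᴺ (N the number of elements) gives xⁱ ≈ xⁱ⁺ᵈ⁺¹; cancelling xⁱ leaves x · xᵈ ≈ 1.
  inverse-is-power : (elements : List Carrier) → (∀ x → Any (x ≈_) elements) →
                     ∀ x → ∃ λ d → ∀ {z} → x * z ≈ 1# → x * x ^ d ≈ 1#
  inverse-is-power elements complete x = from-collision (pigeonhole (ℕ.n<1+n (length elements)) power-index)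
    where
    power-index : Fin (ℕ.suc (length elements)) → Fin (length elements)
    power-index k = index (complete (x ^ toℕ k))

    same-power : ∀ i j → power-index i ≡ power-index j → x ^ toℕ i ≈ x ^ toℕ j
    same-power i j same-index = trans (lookup-index (complete (x ^ toℕ i)))
      (trans (reflexive (≡.cong (lookup elements) same-index)) (sym (lookup-index (complete (x ^ toℕ j)))))

    from-collision : (∃₂ λ i j → i Fin.< j × power-index i ≡ power-index j) →
                     ∃ λ d → ∀ {z} → x * z ≈ 1# → x * x ^ d ≈ 1#
    from-collision (i , j , i<j , same-index) with d , i+1+d≡j ← ℕ.m≤n⇒∃[o]m+o≡n i<j =
      d , λ xz≈1 → ^-cancelˡ-unit xz≈1 (toℕ i) (begin
        x ^ toℕ i * x ^ ℕ.suc d  ≈⟨ ^-homo-* x (toℕ i) (ℕ.suc d) ⟨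
        x ^ (toℕ i ℕ.+ ℕ.suc d)  ≡⟨ ≡.cong (x ^_) (≡.trans (ℕ.+-suc (toℕ i) d) i+1+d≡j) ⟩
        x ^ toℕ j                ≈⟨ same-power i j same-index ⟨
        x ^ toℕ i                ≈⟨ *-identityʳ _ ⟨
        x ^ toℕ i * 1#           ∎)

  record IsIdeal {r} (P : Carrier → Set r) : Set (c ⊔ ℓ ⊔ r) where
    field
      resp     : ∀ {x y} → x ≈ y → P x → P y
      0∈       : P 0#
      +-closed : ∀ {x y} → P x → P y → P (x + y)
      *-closed : ∀ k {x} → P x → P (k * x)

  ¬¬-∀-Fin : ∀ {m r} {Q : Fin m → Set r} → (∀ i → ¬ ¬ Q i) → ¬ ¬ (∀ i → Q i)
  ¬¬-∀-Fin {ℕ.zero}  ¬¬Q ¬∀Q = ¬∀Q (λ ())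
  ¬¬-∀-Fin {ℕ.suc m} ¬¬Q ¬∀Q =
    ¬¬Q zero (λ Q₀ → ¬¬-∀-Fin (¬¬Q ∘ suc) (λ Qₛ → ¬∀Q (λ { zero → Q₀ ; (suc i) → Qₛ i })))

  module _ (ff : IsFiniteField F) where
    open IsFiniteField ff

    quasi-inverse : ∀ x → ∃ λ y → ¬ x ≈ 0# → x * y ≈ 1#
    quasi-inverse x with d , power-inverts ← inverse-is-power elements complete x =
      x ^ d , λ x≉0 → power-inverts (proj₂ (inverse x x≉0))

    -- Equality in F need not be decidable, so no nonzero entry can be singled out; instead all
    -- entries are merged into one ideal element that is 1 as soon as any of them is nonzero.
    join : Carrier → Carrier → Carrier
    join t x = t + (proj₁ (quasi-inverse x) * (1# - t)) * x

    join-≈1ˡ : ∀ {t} x → t ≈ 1# → join t x ≈ 1#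
    join-≈1ˡ {t} x t≈1 = begin
      t + (y * (1# - t)) * x  ≈⟨ +-congˡ (*-congʳ (*-congˡ 1-t≈0)) ⟩
      t + (y * 0#) * x        ≈⟨ +-congˡ (trans (*-congʳ (zeroʳ y)) (zeroˡ x)) ⟩
      t + 0#                  ≈⟨ +-identityʳ t ⟩
      t                       ≈⟨ t≈1 ⟩
      1#                      ∎
      where
      y = proj₁ (quasi-inverse x)
      1-t≈0 : 1# - t ≈ 0#
      1-t≈0 = trans (+-congˡ (-‿cong t≈1)) (-‿inverseʳ 1#)

    join-≈1ʳ : ∀ t {x} → ¬ x ≈ 0# → join t x ≈ 1#
    join-≈1ʳ t {x} x≉0 = begin
      t + (y * (1# - t)) * x  ≈⟨ +-congˡ (rotate y (1# - t) x) ⟩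
      t + (x * y) * (1# - t)  ≈⟨ +-congˡ (trans (*-congʳ (proj₂ (quasi-inverse x) x≉0)) (*-identityˡ _)) ⟩
      t + (1# - t)            ≈⟨ +-comm t _ ⟩
      (1# - t) + t            ≈⟨ //-rightDividesˡ t 1# ⟩
      1#                      ∎
      where
      y = proj₁ (quasi-inverse x)
      rotate : ∀ a b d → (a * b) * d ≈ (d * a) * b
      rotate = solve 3 (λ a b d → (a :* b) :* d := (d :* a) :* b) refl

    module _ {r} {P : Carrier → Set r} (P-ideal : IsIdeal P) where
      open IsIdeal P-ideal

      join-closed : ∀ {t x} → P t → P x → P (join t x)
      join-closed Pt Px = +-closed Pt (*-closed _ Px)

      ideal-witness : ∀ {m} (f : Fin m → Carrier) → (∀ i → P (f i)) →
                      ∃ λ t → P t × (∀ i → ¬ f i ≈ 0# → t ≈ 1#)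
      ideal-witness {ℕ.zero}  f Pf = 0# , 0∈ , λ ()
      ideal-witness {ℕ.suc m} f Pf with t , Pt , t≈1 ← ideal-witness (f ∘ suc) (Pf ∘ suc) =
        join t (f zero) , join-closed Pt (Pf zero) , join≈1
        where
        join≈1 : ∀ i → ¬ f i ≈ 0# → join t (f zero) ≈ 1#
        join≈1 zero    f₀≉0 = join-≈1ʳ t f₀≉0
        join≈1 (suc i) fᵢ≉0 = join-≈1ˡ (f zero) (t≈1 i fᵢ≉0)

      ideal-witnessₘ : ∀ {n} (A : Mat F n) → (∀ i j → P (A i j)) →
                       ∃ λ t → P t × (∀ i j → ¬ A i j ≈ 0# → t ≈ 1#)
      ideal-witnessₘ A PA = merge (ideal-witness (λ i → proj₁ (row i)) (λ i → proj₁ (proj₂ (row i))))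
        where
        row : ∀ i → ∃ λ t → P t × (∀ j → ¬ A i j ≈ 0# → t ≈ 1#)
        row i = ideal-witness (A i) (PA i)
        merge : (∃ λ t → P t × (∀ i → ¬ proj₁ (row i) ≈ 0# → t ≈ 1#)) →
                ∃ λ t → P t × (∀ i j → ¬ A i j ≈ 0# → t ≈ 1#)
        merge (t , Pt , t≈1) =
          t , Pt , λ i j Aᵢⱼ≉0 → t≈1 i (λ tᵢ≈0 → 0≉1 (trans (sym tᵢ≈0) (proj₂ (proj₂ (row i)) j Aᵢⱼ≉0)))

      1∈ideal : ∀ {n} (A : Mat F n) → (∀ i j → P (A i j)) → ¬ A ≈ₘ 0ₘ → P 1#
      1∈ideal A PA A≉0 with t , Pt , t≈1 ← ideal-witnessₘ A PA =
        resp (trans (*-comm _ t) t*t⁻¹≈1) (*-closed (proj₁ (inverse t t≉0)) Pt)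
        where
        t≉0 : ¬ t ≈ 0#
        t≉0 t≈0 = ¬¬-∀-Fin (λ i → ¬¬-∀-Fin (λ j Aᵢⱼ≉0 → 0≉1 (trans (sym t≈0) (t≈1 i j Aᵢⱼ≉0)))) A≉0
        t*t⁻¹≈1 : t * proj₁ (inverse t t≉0) ≈ 1#
        t*t⁻¹≈1 = proj₂ (inverse t t≉0)

  EntryIdeal : ∀ {n q} → (Mat F n → Set q) → Carrier → Set (c ⊔ ℓ ⊔ q)
  EntryIdeal {n} S v = ∀ (k l : Fin n) → IsSumOf S (singleEntry k l v)

  module _ (ff : IsFiniteField F) {n p q} {U : Mat F n → Set p} {S : Mat F n → Set q}
           (U-connected : CayleyConnected F U) (S-conn : IsConnectionSet F n S)
           (USU⊆S : ∀ {u s v} → U u → S s → U v → S (u *ₘ s *ₘ v)) where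
    open IsConnectionSet S-conn using (0∉S) renaming (resp to S-resp)

    sandwich : ∀ {x} → IsSumOf S x → ∀ a b → IsSumOf S (a *ₘ x *ₘ b)
    sandwich = isSumOf-sandwich U-connected S-resp USU⊆S

    entryIdeal-isIdeal : IsIdeal (EntryIdeal S)
    entryIdeal-isIdeal = record
      { resp     = λ v≈w v∈ k l → walk-respˡ S-resp (singleEntry-cong k l v≈w) (v∈ k l)
      ; 0∈       = λ k l → here (singleEntry-zero k l)
      ; +-closed = λ v∈ w∈ k l →
          walk-respˡ S-resp (≈ₘ-sym (singleEntry-+ k l _ _)) (isSumOf-+ S-resp (v∈ k l) (w∈ k l))
      ; *-closed = λ w {v} v∈ k l →
          walk-respˡ S-resp (≈ₘ-trans (singleEntry-sandwich k k l l w 1# (singleEntry k l v))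
                                     (singleEntry-cong k l (trans (*-identityʳ _) (*-congˡ (singleEntry-diag k l v)))))
                     (sandwich (v∈ k l) (singleEntry k k w) (singleEntry l l 1#))
      }

    entries-∈-entryIdeal : ∀ {s} → S s → ∀ i j → EntryIdeal S (s i j)
    entries-∈-entryIdeal {s} s∈S i j k l =
      walk-respˡ S-resp (≈ₘ-trans (singleEntry-sandwich k i j l 1# 1# s)
                                 (singleEntry-cong k l (trans (*-identityʳ _) (*-identityˡ (s i j)))))
                 (sandwich (isSumOf-∈ S-resp s∈S) (singleEntry k i 1#) (singleEntry j l 1#))

    entryIdeal-full : ∀ {s} → S s → ∀ v → EntryIdeal S v
    entryIdeal-full {s} s∈S v = resp (*-identityʳ v) (*-closed v 1∈entryIdeal)
      where
      open IsIdeal entryIdeal-isIdeal using (resp; *-closed)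
      1∈entryIdeal : EntryIdeal S 1#
      1∈entryIdeal = 1∈ideal ff entryIdeal-isIdeal s (entries-∈-entryIdeal s∈S) (λ s≈0 → 0∉S (S-resp s≈0 s∈S))

    every-matrix-isSumOf : ∀ {s} → S s → ∀ x → IsSumOf S x
    every-matrix-isSumOf s∈S x =
      walk-respˡ S-resp (≈ₘ-sym (Σₘ-singleEntries x))
        (isSumOf-Σₘ S-resp n _ (λ k → isSumOf-Σₘ S-resp n _ (λ l → entryIdeal-full s∈S (x k l) k l)))

    unitary-connected : ∀ {s} → S s → CayleyConnected F S
    unitary-connected s∈S = all-isSumOf⇒connected S-resp (every-matrix-isSumOf s∈S)

mainTheorem9 : ∀ {c ℓ p q : Level} (F : CommutativeRing c ℓ) → IsFiniteField F →
    (n : ℕ) → 1 < n →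
    (U : Mat F n → Set p) → IsSubgroupGL F n U → U (-ₘ_ F (Iₘ F)) →
    CayleyConnected F U →
    (S : Mat F n → Set q) → IsConnectionSet F n S → IsUnitary F U S →
    ∃ S →
    CayleyConnected F S
mainTheorem9 F ff _ _ _ _ _ U-connected _ S-conn (USU⊆S , _) (_ , s∈S) =
  unitary-connected F ff U-connected S-conn USU⊆S s∈S
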